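{- Let $G$ be a bipartite outerplanar graph on $n$ vertices with bipartition $(X,Y)$ such that $|Y|\ge |X|\ge 1$. Then $e(G)\le n+|X|-2$.
   Context: A graph is outerplanar if it has a plane embedding in which all vertices lie on the boundary of the outer face. $e(G)$ denotes the number of edges of $G$. -}

module Defs where

open import Data.Nat using (ℕ; _+_; _≤_)
open import Data.Bool using (Bool; true; false; if_then_else_; _∧_)
open import Data.Fin using (Fin; _<_; _<?_)
open import Data.List using (List; map; allFin)
open import Data.Nat.ListAction using (sum)
open import Data.Product using (Σ; _×_)
open import Data.Sum using (_⊎_)
open import Data.Fin.Subset using (Subset; _∈_; _∉_)
open import Function.Definitions using (Injective)
open import Relation.Binary.PropositionalEquality using (_≡_)
open import Relation.Nullary using (does)

record Graph (n : ℕ) : Set where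
  field
    adj    : Fin n → Fin n → Bool
    sym    : ∀ i j → adj i j ≡ adj j i
    irrefl : ∀ i → adj i i ≡ false
open Graph public

e : ∀ {n} → Graph n → ℕ
e {n} G = sum (map (λ i → sum (map (λ j →
            if does (i <? j) ∧ adj G i j then 1 else 0) (allFin n))) (allFin n))

-- Outerplanar: there is an outerplanar embedding, i.e. the vertices can be placed
-- on a circle in some cyclic order (pos : injective, hence bijective, position map)
-- so that no two edges (drawn as chords) cross: there are no vertices a, b, c, d
-- in circular order with ac and bd both edges.
Outerplanar : ∀ {n} → Graph n → Set
Outerplanar {n} G =
  Σ (Fin n → Fin n) λ pos → Injective _≡_ _≡_ pos ×
    (∀ a b c d → pos a < pos b → pos b < pos c → pos c < pos d →
       adj G a c ≡ true → adj G b d ≡ false)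

-- (X, Y) with Y the complement of X is a bipartition of G:
-- every edge has exactly one endpoint in X.
IsBipartition : ∀ {n} → Graph n → Subset n → Set
IsBipartition G X = ∀ i j → adj G i j ≡ true →
  (i ∈ X × j ∉ X) ⊎ (i ∉ X × j ∈ X)

{-# OPTIONS --safe #-}
module Submission where

-- Number the vertices by their position along the outer face. For the set I of vertices
-- whose positions lie in an interval, compare the number e(I) of edges inside I with its
-- weight |I| + |X ∩ I|. By induction on the length of the interval from u to v one shows
-- e(I) + 2 + [u ∈ X or v ∈ X] ≤ |I| + |X ∩ I| + [uv ∈ E] whenever I meets X: if u has no
-- neighbour strictly between u and v, drop u; otherwise let k be the farthest such
-- neighbour. Since chords do not cross, every edge inside I then lies inside [u, k], lies
-- inside [k, v], or is uv. The interval of all positions gives e(G) + 2 ≤ n + |X|.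

open import Defs
open import Data.Nat using (ℕ; _+_; _≤_)
open import Data.Fin.Subset using (Subset; ∣_∣; ∁)

import Data.Nat.Properties as ℕ
open import Algebra.Properties.CommutativeMonoid.Sum ℕ.+-0-commutativeMonoid
  using (sum-syntax; sum-cong-≗; ∑-distrib-+; ∑-comm)
open import Data.Bool using (Bool; true; false; T; not; _∧_; _∨_; if_then_else_)
open import Data.Bool.Properties using (T-∧; T-∨; T-≡; ∧-zeroʳ)
open import Data.Empty using (⊥; ⊥-elim)
open import Data.Fin using (Fin; zero; suc; toℕ; _≟_; _<?_)
import Data.Fin.Properties as Fin
open import Data.Fin.Subset using (_∉_)
open import Data.List using (List; []; _∷_; map; allFin; tabulate; filter)
open import Data.List.Extrema (ℕ.≤-totalOrder)
  using (argmin; argmax; argmin-all; argmax-all; f[argmin]≤f[xs]; f[xs]≤f[argmax])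
open import Data.List.Membership.Propositional using () renaming (_∈_ to _∈ᴸ_)
open import Data.List.Membership.Propositional.Properties using (∈-allFin; ∈-filter⁺)
import Data.List.Relation.Unary.All as All
open import Data.List.Relation.Unary.All.Properties using (all-filter)
open import Data.Nat using (zero; suc; _*_; _<_; _≤?_; z≤n; s≤s)
import Data.Nat.ListAction as List
open import Data.Nat.Properties
  using (≤-refl; ≤-trans; ≤-reflexive; ≤-antisym; <⇒≤; <⇒≱; ≰⇒>; ≮⇒≥; ≤-pred; <-≤-trans; m≤n⇒m<n∨m≡n;
         +-mono-≤; +-monoˡ-≤; +-monoʳ-≤; m≤m+n; m≤n+m; +-identityʳ; +-assoc; +-suc; module ≤-Reasoning)
open import Data.Nat.Tactic.RingSolver using (solve)
open import Data.Product using (∃; _×_; _,_; proj₁; proj₂; swap)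
import Data.Product as Product
open import Data.Sum using (_⊎_; inj₁; inj₂)
import Data.Sum as Sum
open import Data.Vec using (lookup)
import Data.Vec as Vec
open import Data.Vec.Properties using ([]=⇒lookup; lookup⇒[]=)
open import Function using (_∘_; id; Equivalence)
open import Relation.Binary.Definitions using (tri<; tri≈; tri>)
open import Relation.Binary.PropositionalEquality as ≡ using (_≡_; refl; cong; subst)
open import Relation.Nullary using (Dec; yes; no; does; ¬_)
open import Relation.Nullary.Decidable using (dec-true; dec-false; _×-dec_; T?)
open import Relation.Nullary.Negation using (contradiction)
open import Relation.Unary using (Pred; Decidable)

private variable n : ℕ

T-does⁺ : ∀ {p} {P : Set p} (P? : Dec P) → P → T (does P?)
T-does⁺ (yes _) _ = _
T-does⁺ (no ¬p) p = ¬p p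

T-does⁻ : ∀ {p} {P : Set p} (P? : Dec P) → T (does P?) → P
T-does⁻ (yes p) _ = p

T-∧⁺ : ∀ {a b} → T a → T b → T (a ∧ b)
T-∧⁺ Ta Tb = Equivalence.from T-∧ (Ta , Tb)

T-∧⁻ : ∀ {a b} → T (a ∧ b) → T a × T b
T-∧⁻ = Equivalence.to T-∧

T-∨⁺ : ∀ {a b} → T a ⊎ T b → T (a ∨ b)
T-∨⁺ = Equivalence.from T-∨

T-ext : ∀ {a b} → (T a → T b) → (T b → T a) → a ≡ b
T-ext {false} {false} _ _ = refl
T-ext {false} {true}  _ b⇒a = ⊥-elim (b⇒a _)
T-ext {true}  {false} a⇒b _ = ⊥-elim (a⇒b _)
T-ext {true}  {true}  _ _ = refl

⌊_⌋ : Bool → ℕ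
⌊ b ⌋ = if b then 1 else 0

⌊⌋-mono : ∀ {a b} → (T a → T b) → ⌊ a ⌋ ≤ ⌊ b ⌋
⌊⌋-mono {false}        _   = z≤n
⌊⌋-mono {true} {true}  _   = ≤-refl
⌊⌋-mono {true} {false} a⇒b = ⊥-elim (a⇒b _)

⌊⌋≤1 : ∀ b → ⌊ b ⌋ ≤ 1
⌊⌋≤1 false = z≤n
⌊⌋≤1 true  = ≤-refl

⌊¬⌋≡0 : ∀ {b} → ¬ T b → ⌊ b ⌋ ≡ 0
⌊¬⌋≡0 {false} _ = refl
⌊¬⌋≡0 {true}  ¬b = ⊥-elim (¬b _)

⌊∨⌋≤ : ∀ a b → ⌊ a ∨ b ⌋ ≤ ⌊ a ⌋ + ⌊ b ⌋
⌊∨⌋≤ false _ = ≤-refl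
⌊∨⌋≤ true  b = m≤m+n 1 ⌊ b ⌋

∑-mono-≤ : {f g : Fin n → ℕ} → (∀ i → f i ≤ g i) → ∑[ i < n ] f i ≤ ∑[ i < n ] g i
∑-mono-≤ {zero}  _   = z≤n
∑-mono-≤ {suc n} f≤g = +-mono-≤ (f≤g zero) (∑-mono-≤ (f≤g ∘ suc))

∑-zero : {f : Fin n → ℕ} → (∀ i → f i ≡ 0) → ∑[ i < n ] f i ≡ 0
∑-zero {zero}  _   = refl
∑-zero {suc n} f≡0 = ≡.cong₂ _+_ (f≡0 zero) (∑-zero (f≡0 ∘ suc))

count : (Fin n → Bool) → ℕ
count {n} P = ∑[ i < n ] ⌊ P i ⌋

count₂ : (Fin n → Fin n → Bool) → ℕ
count₂ {n} P = ∑[ i < n ] count (P i)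

count-mono : {P Q : Fin n → Bool} → (∀ i → T (P i) → T (Q i)) → count P ≤ count Q
count-mono P⇒Q = ∑-mono-≤ (λ i → ⌊⌋-mono (P⇒Q i))

count-∨ : (P Q : Fin n → Bool) → count (λ i → P i ∨ Q i) ≤ count P + count Q
count-∨ {n} P Q =
  ≤-trans (∑-mono-≤ (λ i → ⌊∨⌋≤ (P i) (Q i))) (≤-reflexive (∑-distrib-+ {n} (⌊_⌋ ∘ P) (⌊_⌋ ∘ Q)))

count-at : (u : Fin n) (P : Fin n → Bool) → count (λ i → does (i ≟ u) ∧ P i) ≡ ⌊ P u ⌋
count-at {suc n} zero    P = ≡.trans (cong (⌊ P zero ⌋ +_) (∑-zero {n} (λ _ → refl))) (+-identityʳ _)
count-at {suc n} (suc u) P = count-at u (P ∘ suc)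

count₂-mono : {P Q : Fin n → Fin n → Bool} → (∀ i j → T (P i j) → T (Q i j)) → count₂ P ≤ count₂ Q
count₂-mono P⇒Q = ∑-mono-≤ (λ i → count-mono (P⇒Q i))

count₂-∨ : (P Q : Fin n → Fin n → Bool) → count₂ (λ i j → P i j ∨ Q i j) ≤ count₂ P + count₂ Q
count₂-∨ {n} P Q =
  ≤-trans (∑-mono-≤ (λ i → count-∨ (P i) (Q i))) (≤-reflexive (∑-distrib-+ {n} (count ∘ P) (count ∘ Q)))

count₂-none : (P : Fin n → Fin n → Bool) → (∀ i j → ¬ T (P i j)) → count₂ P ≡ 0
count₂-none P none = ∑-zero (λ i → ∑-zero (λ j → ⌊¬⌋≡0 (none i j)))

count₂-at : (u v : Fin n) (P : Fin n → Fin n → Bool) →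
            count₂ (λ i j → does (i ≟ u) ∧ does (j ≟ v) ∧ P i j) ≡ ⌊ P u v ⌋
count₂-at {n} u v P = begin
  ∑[ i < n ] ∑[ j < n ] ⌊ does (i ≟ u) ∧ does (j ≟ v) ∧ P i j ⌋
    ≡⟨ ∑-comm {n} {n} (λ i j → ⌊ does (i ≟ u) ∧ does (j ≟ v) ∧ P i j ⌋) ⟩
  ∑[ j < n ] ∑[ i < n ] ⌊ does (i ≟ u) ∧ does (j ≟ v) ∧ P i j ⌋
    ≡⟨ sum-cong-≗ (λ j → count-at u (λ i → does (j ≟ v) ∧ P i j)) ⟩
  ∑[ j < n ] ⌊ does (j ≟ v) ∧ P u j ⌋
    ≡⟨ count-at v (P u) ⟩
  ⌊ P u v ⌋ ∎
  where open ≡.≡-Reasoning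

sumOver : (Fin n → Bool) → (Fin n → ℕ) → ℕ
sumOver {n} R f = ∑[ i < n ] (⌊ R i ⌋ * f i)

sumOver-cong : {R S : Fin n → Bool} (f : Fin n → ℕ) → (∀ i → R i ≡ S i) → sumOver R f ≡ sumOver S f
sumOver-cong f R≗S = sum-cong-≗ (λ i → cong (λ b → ⌊ b ⌋ * f i) (R≗S i))

sumOver-split : (R S₁ S₂ : Fin n → Bool) (f : Fin n → ℕ) →
  (∀ i → ⌊ R i ⌋ ≡ ⌊ S₁ i ⌋ + ⌊ S₂ i ⌋) → sumOver R f ≡ sumOver S₁ f + sumOver S₂ f
sumOver-split {n} R S₁ S₂ f split = ≡.trans
  (sum-cong-≗ (λ i → ≡.trans (cong (_* f i) (split i)) (ℕ.*-distribʳ-+ (f i) ⌊ S₁ i ⌋ ⌊ S₂ i ⌋)))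
  (∑-distrib-+ {n} (λ i → ⌊ S₁ i ⌋ * f i) (λ i → ⌊ S₂ i ⌋ * f i))

sumOver-exchange : (R₁ R₂ S₁ S₂ : Fin n → Bool) (f : Fin n → ℕ) →
  (∀ i → ⌊ R₁ i ⌋ + ⌊ R₂ i ⌋ ≡ ⌊ S₁ i ⌋ + ⌊ S₂ i ⌋) →
  sumOver R₁ f + sumOver R₂ f ≡ sumOver S₁ f + sumOver S₂ f
sumOver-exchange {n} R₁ R₂ S₁ S₂ f exchange = begin
  sumOver R₁ f + sumOver R₂ f
    ≡⟨ ∑-distrib-+ {n} (λ i → ⌊ R₁ i ⌋ * f i) (λ i → ⌊ R₂ i ⌋ * f i) ⟨
  ∑[ i < n ] (⌊ R₁ i ⌋ * f i + ⌊ R₂ i ⌋ * f i)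
    ≡⟨ sum-cong-≗ (λ i → through (f i) ⌊ R₁ i ⌋ ⌊ R₂ i ⌋ ⌊ S₁ i ⌋ ⌊ S₂ i ⌋ (exchange i)) ⟩
  ∑[ i < n ] (⌊ S₁ i ⌋ * f i + ⌊ S₂ i ⌋ * f i)
    ≡⟨ ∑-distrib-+ {n} (λ i → ⌊ S₁ i ⌋ * f i) (λ i → ⌊ S₂ i ⌋ * f i) ⟩
  sumOver S₁ f + sumOver S₂ f ∎
  where
  open ≡.≡-Reasoning
  through : ∀ x a b c d → a + b ≡ c + d → a * x + b * x ≡ c * x + d * x
  through x a b c d eq = ≡.trans (≡.sym (ℕ.*-distribʳ-+ x a b))
    (≡.trans (cong (_* x) eq) (ℕ.*-distribʳ-+ x c d))

sumOver-at : (u : Fin n) (f : Fin n → ℕ) → sumOver (λ i → does (i ≟ u)) f ≡ f u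
sumOver-at {suc n} zero    f =
  ≡.trans (≡.cong₂ _+_ (+-identityʳ (f zero)) (∑-zero {n} (λ _ → refl))) (+-identityʳ _)
sumOver-at {suc n} (suc u) f = sumOver-at u (f ∘ suc)

sumOver-member : (R : Fin n → Bool) (f : Fin n → ℕ) {w : Fin n} → T (R w) → f w ≤ sumOver R f
sumOver-member R f {zero}  Rw with R zero
... | true = ≤-trans (ℕ.m≤m+n (f zero) 0) (m≤m+n _ _)
sumOver-member R f {suc w} Rw = ≤-trans (sumOver-member (R ∘ suc) (f ∘ suc) Rw) (m≤n+m _ (⌊ R zero ⌋ * f zero))

sumOver-witness : (R : Fin n → Bool) (f : Fin n → ℕ) → 1 ≤ sumOver R f → ∃ λ i → T (R i)
sumOver-witness {suc n} R f positive with R zero in R0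
... | true  = zero , Equivalence.from T-≡ R0
... | false = Product.map suc id (sumOver-witness (R ∘ suc) (f ∘ suc) positive)

module Extremes {ℓ} {P : Pred (Fin n) ℓ} (P? : Decidable P) (f : Fin n → ℕ) {w : Fin n} (Pw : P w) where

  private
    candidates : List (Fin n)
    candidates = filter P? (allFin n)

    candidate : ∀ {x} → P x → x ∈ᴸ candidates
    candidate Px = ∈-filter⁺ P? (∈-allFin _) Px

  minimiser : ∃ λ u → P u × (∀ {x} → P x → f u ≤ f x)
  minimiser = argmin f w candidates , argmin-all f Pw (all-filter P? (allFin n)) ,
    λ Px → All.lookup (f[argmin]≤f[xs] {f = f} w candidates) (candidate Px)

  maximiser : ∃ λ v → P v × (∀ {x} → P x → f x ≤ f v)
  maximiser = argmax f w candidates , argmax-all f Pw (all-filter P? (allFin n)) ,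
    λ Px → All.lookup (f[xs]≤f[argmax] {f = f} w candidates) (candidate Px)

range : ℕ → ℕ → ℕ → Bool
range s t m = does (s ≤? m) ∧ does (m ≤? t)

range-in : ∀ {s t m} → s ≤ m → m ≤ t → range s t m ≡ true
range-in {s} {t} {m} s≤m m≤t rewrite dec-true (s ≤? m) s≤m | dec-true (m ≤? t) m≤t = refl

range-below : ∀ {s t m} → m < s → range s t m ≡ false
range-below {s} {t} {m} m<s rewrite dec-false (s ≤? m) (<⇒≱ m<s) = refl

range-above : ∀ {s t m} → t < m → range s t m ≡ false
range-above {s} {t} {m} t<m rewrite dec-false (m ≤? t) (<⇒≱ t<m) = ∧-zeroʳ (does (s ≤? m))

T-range⁺ : ∀ {s t m} → s ≤ m → m ≤ t → T (range s t m)
T-range⁺ {s} {t} {m} s≤m m≤t = T-∧⁺ (T-does⁺ (s ≤? m) s≤m) (T-does⁺ (m ≤? t) m≤t)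

T-range⁻ : ∀ {s t m} → T (range s t m) → s ≤ m × m ≤ t
T-range⁻ {s} {t} {m} m∈ = Product.map (T-does⁻ (s ≤? m)) (T-does⁻ (m ≤? t)) (T-∧⁻ m∈)

range-split-first : ∀ {s t} m → s ≤ t → ⌊ range s t m ⌋ ≡ ⌊ range s s m ⌋ + ⌊ range (suc s) t m ⌋
range-split-first {s} {t} m s≤t with ℕ.<-cmp m s
... | tri< m<s _ _ rewrite range-below {t = t} m<s | range-below {t = s} m<s
                         | range-below {t = t} (ℕ.m<n⇒m<1+n m<s) = refl
... | tri≈ _ refl _ rewrite range-in ≤-refl s≤t | range-in (≤-refl {m}) (≤-refl {m})
                          | range-below {t = t} (ℕ.n<1+n m) = refl
... | tri> _ _ s<m with m ≤? t
...   | yes m≤t rewrite range-in (<⇒≤ s<m) m≤t | range-above {s} s<m | range-in s<m m≤t = refl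
...   | no m≰t  rewrite range-above {s} (≰⇒> m≰t) | range-above {s} s<m | range-above {suc s} (≰⇒> m≰t) = refl

range-split-at : ∀ {s r t} m → s ≤ r → r ≤ t →
                 ⌊ range s t m ⌋ + ⌊ range r r m ⌋ ≡ ⌊ range s r m ⌋ + ⌊ range r t m ⌋
range-split-at {s} {r} {t} m s≤r r≤t with ℕ.<-cmp m r
... | tri< m<r _ _ rewrite range-below {t = r} m<r | range-below {t = t} m<r
                         | dec-true (m ≤? t) (≤-trans (<⇒≤ m<r) r≤t) | dec-true (m ≤? r) (<⇒≤ m<r) = refl
... | tri≈ _ refl _ rewrite range-in s≤r r≤t | range-in (≤-refl {m}) (≤-refl {m})
                          | range-in s≤r (≤-refl {m}) | range-in (≤-refl {m}) r≤t = refl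
... | tri> _ _ r<m rewrite range-above {r} r<m | range-above {s} r<m
                         | dec-true (s ≤? m) (≤-trans s≤r (<⇒≤ r<m)) | dec-true (r ≤? m) (<⇒≤ r<m) =
  ℕ.+-comm ⌊ does (m ≤? t) ⌋ 0

edgeIn : Graph n → (Fin n → Bool) → Fin n → Fin n → Bool
edgeIn G R i j = R i ∧ R j ∧ (does (i <? j) ∧ adj G i j)

edgesWithin : Graph n → (Fin n → Bool) → ℕ
edgesWithin G R = count₂ (edgeIn G R)

edgesWithin-cong : (G : Graph n) {R S : Fin n → Bool} → (∀ i → R i ≡ S i) → edgesWithin G R ≡ edgesWithin G S
edgesWithin-cong G R≗S = sum-cong-≗ λ i → sum-cong-≗ λ j →
  cong ⌊_⌋ (≡.cong₂ (λ a b → a ∧ b ∧ (does (i <? j) ∧ adj G i j)) (R≗S i) (R≗S j))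

Both : (Fin n → Bool) → Fin n → Fin n → Set
Both R i j = T (R i) × T (R j)

edgeIn⁻ : (G : Graph n) (R : Fin n → Bool) {i j : Fin n} → T (edgeIn G R i j) → Both R i j × T (adj G i j)
edgeIn⁻ G R Wij with Ri , RjE ← T-∧⁻ Wij with Rj , Eij ← T-∧⁻ RjE = (Ri , Rj) , proj₂ (T-∧⁻ Eij)

EdgesCovered : Graph n → (R S₁ S₂ : Fin n → Bool) → Fin n → Fin n → Set
EdgesCovered G R S₁ S₂ u v = ∀ i j → T (adj G i j) → Both R i j →
  Both S₁ i j ⊎ Both S₂ i j ⊎ (i ≡ u × j ≡ v) ⊎ (i ≡ v × j ≡ u)

adj-sym : (G : Graph n) {i j : Fin n} → T (adj G i j) → T (adj G j i)
adj-sym G {i} {j} = subst T (sym G i j)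

adj-irrefl : (G : Graph n) {i : Fin n} → ¬ T (adj G i i)
adj-irrefl G {i} = subst T (irrefl G i)

oriented-edge : (G : Graph n) (u v : Fin n) →
  ⌊ does (u <? v) ∧ adj G u v ⌋ + ⌊ does (v <? u) ∧ adj G v u ⌋ ≡ ⌊ adj G u v ⌋
oriented-edge G u v with Fin.<-cmp u v
... | tri< u<v _ _ rewrite dec-true (u <? v) u<v | dec-false (v <? u) (Fin.<-asym u<v) = +-identityʳ _
... | tri≈ _ refl _ rewrite dec-false (u <? u) (Fin.<-irrefl refl) | irrefl G u = refl
... | tri> _ _ v<u rewrite dec-false (u <? v) (Fin.<-asym v<u) | dec-true (v <? u) v<u = cong ⌊_⌋ (sym G v u)

edgesWithin-cover : (G : Graph n) {R S₁ S₂ : Fin n → Bool} {u v : Fin n} →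
  EdgesCovered G R S₁ S₂ u v →
  edgesWithin G R ≤ edgesWithin G S₁ + edgesWithin G S₂ + ⌊ adj G u v ⌋
edgesWithin-cover G {R} {S₁} {S₂} {u} {v} covered = begin
  edgesWithin G R
    ≤⟨ count₂-mono split ⟩
  count₂ (λ i j → W S₁ i j ∨ W S₂ i j ∨ A u v i j ∨ A v u i j)
    ≤⟨ count₂-∨ (W S₁) (λ i j → W S₂ i j ∨ A u v i j ∨ A v u i j) ⟩
  e₁ + count₂ (λ i j → W S₂ i j ∨ A u v i j ∨ A v u i j)
    ≤⟨ +-monoʳ-≤ e₁ (count₂-∨ (W S₂) (λ i j → A u v i j ∨ A v u i j)) ⟩
  e₁ + (e₂ + count₂ (λ i j → A u v i j ∨ A v u i j))
    ≤⟨ +-monoʳ-≤ e₁ (+-monoʳ-≤ e₂ (count₂-∨ (A u v) (A v u))) ⟩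
  e₁ + (e₂ + (count₂ (A u v) + count₂ (A v u)))
    ≡⟨ cong (λ k → e₁ + (e₂ + k))
         (≡.trans (≡.cong₂ _+_ (count₂-at u v E) (count₂-at v u E)) (oriented-edge G u v)) ⟩
  e₁ + (e₂ + ⌊ adj G u v ⌋)
    ≡⟨ +-assoc e₁ e₂ ⌊ adj G u v ⌋ ⟨
  e₁ + e₂ + ⌊ adj G u v ⌋ ∎
  where
  open ≤-Reasoning
  e₁ = edgesWithin G S₁
  e₂ = edgesWithin G S₂
  E : Fin _ → Fin _ → Bool
  E i j = does (i <? j) ∧ adj G i j
  W : (Fin _ → Bool) → Fin _ → Fin _ → Bool
  W S i j = S i ∧ S j ∧ E i j
  A : Fin _ → Fin _ → Fin _ → Fin _ → Bool
  A a b i j = does (i ≟ a) ∧ does (j ≟ b) ∧ E i j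
  E⁺ : ∀ {i j} → T (W R i j) → T (E i j)
  E⁺ {i} {j} Wij = proj₂ (T-∧⁻ {R j} (proj₂ (T-∧⁻ {R i} Wij)))
  within : ∀ {S i j} → Both S i j → T (E i j) → T (W S i j)
  within (Si , Sj) Eij = T-∧⁺ Si (T-∧⁺ Sj Eij)
  at : ∀ {a b} → T (E a b) → T (A a b a b)
  at {a} {b} Eab = T-∧⁺ (T-does⁺ (a ≟ a) refl) (T-∧⁺ (T-does⁺ (b ≟ b) refl) Eab)
  split : ∀ i j → T (W R i j) → T (W S₁ i j ∨ W S₂ i j ∨ A u v i j ∨ A v u i j)
  split i j Wij with Rij , a ← edgeIn⁻ G R Wij with covered i j a Rij
  ... | inj₁ S₁ij                        = T-∨⁺ {W S₁ i j} (inj₁ (within S₁ij (E⁺ Wij)))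
  ... | inj₂ (inj₁ S₂ij)                 = T-∨⁺ {W S₁ i j} (inj₂ (T-∨⁺ {W S₂ i j} (inj₁ (within S₂ij (E⁺ Wij)))))
  ... | inj₂ (inj₂ (inj₁ (refl , refl))) =
    T-∨⁺ {W S₁ i j} (inj₂ (T-∨⁺ {W S₂ i j} (inj₂ (T-∨⁺ {A u v i j} (inj₁ (at (E⁺ Wij)))))))
  ... | inj₂ (inj₂ (inj₂ (refl , refl))) =
    T-∨⁺ {W S₁ i j} (inj₂ (T-∨⁺ {W S₂ i j} (inj₂ (T-∨⁺ {A u v i j} (inj₂ (at (E⁺ Wij)))))))

drop-X-arith : ∀ {e e′ a b b′} → e ≤ e′ + a → e′ + 1 ≤ b′ → b ≡ 2 + b′ → e + 2 + 1 ≤ b + a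
drop-X-arith {e} {e′} {a} {b} {b′} e≤ e′≤ b≡ = begin
  e + 2 + 1          ≤⟨ +-monoˡ-≤ 1 (+-monoˡ-≤ 2 e≤) ⟩
  e′ + a + 2 + 1     ≡⟨ solve (e′ ∷ a ∷ []) ⟩
  (e′ + 1) + (2 + a) ≤⟨ +-monoˡ-≤ (2 + a) e′≤ ⟩
  b′ + (2 + a)       ≡⟨ solve (b′ ∷ a ∷ []) ⟩
  2 + b′ + a         ≡⟨ cong (_+ a) b≡ ⟨
  b + a              ∎
  where open ≤-Reasoning

drop-Y-arith : ∀ {e e′ a b b′ c} → e ≤ e′ + a → e′ + 2 ≤ b′ → b ≡ 1 + b′ → c ≤ 1 → e + 2 + c ≤ b + a
drop-Y-arith {e} {e′} {a} {b} {b′} {c} e≤ e′≤ b≡ c≤1 = begin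
  e + 2 + c          ≤⟨ +-mono-≤ (+-monoˡ-≤ 2 e≤) c≤1 ⟩
  e′ + a + 2 + 1     ≡⟨ solve (e′ ∷ a ∷ []) ⟩
  (e′ + 2) + (1 + a) ≤⟨ +-monoˡ-≤ (1 + a) e′≤ ⟩
  b′ + (1 + a)       ≡⟨ solve (b′ ∷ a ∷ []) ⟩
  1 + b′ + a         ≡⟨ cong (_+ a) b≡ ⟨
  b + a              ∎
  where open ≤-Reasoning

split-X-arith : ∀ {e e₁ e₂ a b b₁ b₂} → e ≤ e₁ + e₂ + a → e₁ + 2 ≤ b₁ → e₂ + 2 ≤ b₂ → b + 1 ≡ b₁ + b₂ →
                e + 2 + 1 ≤ b + a
split-X-arith {e} {e₁} {e₂} {a} {b} {b₁} {b₂} e≤ e₁≤ e₂≤ b≡ = ℕ.+-cancelʳ-≤ 1 (e + 2 + 1) (b + a) (begin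
  e + 2 + 1 + 1                 ≤⟨ +-monoˡ-≤ 1 (+-monoˡ-≤ 1 (+-monoˡ-≤ 2 e≤)) ⟩
  e₁ + e₂ + a + 2 + 1 + 1       ≡⟨ solve (e₁ ∷ e₂ ∷ a ∷ []) ⟩
  (e₁ + 2) + (e₂ + 2) + a       ≤⟨ +-monoˡ-≤ a (+-mono-≤ e₁≤ e₂≤) ⟩
  b₁ + b₂ + a                   ≡⟨ cong (_+ a) b≡ ⟨
  b + 1 + a                     ≡⟨ solve (b ∷ a ∷ []) ⟩
  b + a + 1                     ∎)
  where open ≤-Reasoning

split-Y-arith : ∀ {e e₁ e₂ a a₂ b b₁ b₂ c} → e ≤ e₁ + e₂ + a → e₁ + 2 ≤ b₁ → e₂ + 2 + 1 ≤ b₂ + a₂ →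
                b + 2 ≡ b₁ + b₂ → a₂ + c ≤ 1 → e + 2 + c ≤ b + a
split-Y-arith {e} {e₁} {e₂} {a} {a₂} {b} {b₁} {b₂} {c} e≤ e₁≤ e₂≤ b≡ a₂+c≤1 =
  ℕ.+-cancelʳ-≤ 5 (e + 2 + c) (b + a) (begin
  e + 2 + c + 5                       ≤⟨ +-monoˡ-≤ 5 (+-monoˡ-≤ c (+-monoˡ-≤ 2 e≤)) ⟩
  e₁ + e₂ + a + 2 + c + 5             ≡⟨ solve (e₁ ∷ e₂ ∷ a ∷ c ∷ []) ⟩
  (e₁ + 2) + (e₂ + 2 + 1) + (a + c + 2) ≤⟨ +-monoˡ-≤ (a + c + 2) (+-mono-≤ e₁≤ e₂≤) ⟩
  b₁ + (b₂ + a₂) + (a + c + 2)        ≡⟨ solve (b₁ ∷ b₂ ∷ a₂ ∷ a ∷ c ∷ []) ⟩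
  (b₁ + b₂) + a + (a₂ + c) + 2        ≡⟨ cong (λ x → x + a + (a₂ + c) + 2) b≡ ⟨
  b + 2 + a + (a₂ + c) + 2            ≤⟨ +-monoˡ-≤ 2 (+-monoʳ-≤ (b + 2 + a) a₂+c≤1) ⟩
  b + 2 + a + 1 + 2                   ≡⟨ solve (b ∷ a ∷ []) ⟩
  b + a + 5                           ∎)
  where open ≤-Reasoning

chord-arith : ∀ {e b a c} → e + 2 + c ≤ b + a → a ≤ c → e + 2 ≤ b
chord-arith {e} {b} {a} {c} e≤ a≤c = ℕ.+-cancelʳ-≤ c (e + 2) b (≤-trans e≤ (+-monoʳ-≤ b a≤c))

module OuterplanarColouring {n : ℕ} (G : Graph n) (O : Outerplanar G)
  (χ : Fin n → Bool) (proper : ∀ {i j} → T (adj G i j) → χ j ≡ not (χ i)) where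

  pos : Fin n → ℕ
  pos w = toℕ (proj₁ O w)

  pos-injective : ∀ {i j} → pos i ≡ pos j → i ≡ j
  pos-injective = proj₁ (proj₂ O) ∘ Fin.toℕ-injective

  chords-do-not-cross : ∀ {a b c d} → pos a < pos b → pos b < pos c → pos c < pos d →
                        T (adj G a c) → ¬ T (adj G b d)
  chords-do-not-cross ab bc cd ac = subst T (proj₂ (proj₂ O) _ _ _ _ ab bc cd (Equivalence.to T-≡ ac))

  ⟦_,_⟧ : ℕ → ℕ → Fin n → Bool
  ⟦ s , t ⟧ w = range s t (pos w)

  -- 2 on X and 1 elsewhere, so that sumOver R weight = |R| + |X ∩ R|
  weight : Fin n → ℕ
  weight w = 1 + ⌊ χ w ⌋

  #X : (Fin n → Bool) → ℕ
  #X R = sumOver R (λ w → ⌊ χ w ⌋)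

  edges : (Fin n → Bool) → ℕ
  edges = edgesWithin G

  point-interval : ∀ u w → ⟦ pos u , pos u ⟧ w ≡ does (w ≟ u)
  point-interval u w with w ≟ u
  ... | yes refl = range-in (≤-refl {pos u}) ≤-refl
  ... | no w≢u with ℕ.<-cmp (pos w) (pos u)
  ...   | tri< w<u _ _ = range-below {pos u} {pos u} w<u
  ...   | tri≈ _ w≡u _ = contradiction (pos-injective w≡u) w≢u
  ...   | tri> _ _ u<w = range-above {pos u} {pos u} u<w

  sumOver-point : ∀ u f → sumOver ⟦ pos u , pos u ⟧ f ≡ f u
  sumOver-point u f = ≡.trans (sumOver-cong f (point-interval u)) (sumOver-at u f)

  sumOver-first : ∀ u {t} f → pos u ≤ t → sumOver ⟦ pos u , t ⟧ f ≡ f u + sumOver ⟦ suc (pos u) , t ⟧ f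
  sumOver-first u {t} f u≤t =
    ≡.trans (sumOver-split ⟦ pos u , t ⟧ ⟦ pos u , pos u ⟧ ⟦ suc (pos u) , t ⟧ f
               (λ w → range-split-first (pos w) u≤t))
            (cong (_+ sumOver ⟦ suc (pos u) , t ⟧ f) (sumOver-point u f))

  sumOver-cut : ∀ k {s t} f → s ≤ pos k → pos k ≤ t →
    sumOver ⟦ s , t ⟧ f + f k ≡ sumOver ⟦ s , pos k ⟧ f + sumOver ⟦ pos k , t ⟧ f
  sumOver-cut k {s} {t} f s≤k k≤t = ≡.trans (cong (sumOver ⟦ s , t ⟧ f +_) (≡.sym (sumOver-point k f)))
    (sumOver-exchange ⟦ s , t ⟧ ⟦ pos k , pos k ⟧ ⟦ s , pos k ⟧ ⟦ pos k , t ⟧ f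
      (λ w → range-split-at (pos w) s≤k k≤t))

  #X-member : ∀ R {w} → T (R w) → χ w ≡ true → 1 ≤ #X R
  #X-member R Rw χw = subst (λ b → ⌊ b ⌋ ≤ #X R) χw (sumOver-member R (λ w → ⌊ χ w ⌋) Rw)

  weight-member : ∀ R {w} → T (R w) → 1 ≤ sumOver R weight
  weight-member R Rw = ≤-trans (s≤s z≤n) (sumOver-member R weight Rw)

  edge-meets-X : ∀ {i j} → T (adj G i j) → χ i ≡ true ⊎ χ j ≡ true
  edge-meets-X {i} a with χ i in χi
  ... | true  = inj₁ refl
  ... | false = inj₂ (≡.trans (proper a) (cong not χi))

  adj≤χ∨χ : ∀ u v → ⌊ adj G u v ⌋ ≤ ⌊ χ u ∨ χ v ⌋
  adj≤χ∨χ u v = ⌊⌋-mono (T-∨⁺ ∘ Sum.map (Equivalence.from T-≡) (Equivalence.from T-≡) ∘ edge-meets-X)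

  adj+χ≤1 : ∀ {k v} → χ k ≡ true → ⌊ adj G k v ⌋ + ⌊ χ v ⌋ ≤ 1
  adj+χ≤1 {k} {v} χk with adj G k v in kv | χ v in χv
  ... | false | c     = ⌊⌋≤1 c
  ... | true  | false = ≤-refl
  ... | true  | true  = contradiction
    (≡.trans (≡.sym χv) (≡.trans (proper (Equivalence.from T-≡ kv)) (cong not χk))) λ ()

  edges-colourless : ∀ {R} → #X R ≡ 0 → edges R ≡ 0
  edges-colourless {R} none = count₂-none (edgeIn G R) λ i j Wij →
    let (Ri , Rj) , a = edgeIn⁻ G R Wij in Sum.[ X-free Ri , X-free Rj ] (edge-meets-X a)
    where
    X-free : ∀ {w} → T (R w) → χ w ≡ true → ⊥
    X-free Rw χw = contradiction (subst (1 ≤_) none (#X-member R Rw χw)) λ ()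

  edges-empty : edges (λ _ → false) ≡ 0
  edges-empty = count₂-none (edgeIn G (λ _ → false)) λ _ _ ()

  edges-point : ∀ u → edges ⟦ pos u , pos u ⟧ ≡ 0
  edges-point u = count₂-none (edgeIn G ⟦ pos u , pos u ⟧) λ i j Wij →
    let (Ri , Rj) , a = edgeIn⁻ G ⟦ pos u , pos u ⟧ Wij in
    adj-irrefl G (subst (λ x → T (adj G i x)) (≡.trans (at Rj) (≡.sym (at Ri))) a)
    where
    at : ∀ {w} → T (⟦ pos u , pos u ⟧ w) → w ≡ u
    at {w} Rw = T-does⁻ (w ≟ u) (subst T (point-interval u w) Rw)

  covered-if-ordered : ∀ {R S₁ S₂ u v} →
    (∀ {i j} → pos i ≤ pos j → T (adj G i j) → Both R i j →
               Both S₁ i j ⊎ Both S₂ i j ⊎ (i ≡ u × j ≡ v)) →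
    EdgesCovered G R S₁ S₂ u v
  covered-if-ordered ordered i j a (Ri , Rj) with ℕ.≤-total (pos i) (pos j)
  ... | inj₁ i≤j = Sum.map₂ (Sum.map₂ inj₁) (ordered i≤j a (Ri , Rj))
  ... | inj₂ j≤i = Sum.map swap (Sum.map swap (inj₂ ∘ swap)) (ordered j≤i (adj-sym G a) (Rj , Ri))

  NeighbourBetween : Fin n → Fin n → Fin n → Set
  NeighbourBetween u v w = T (adj G u w) × pos u < pos w × pos w < pos v

  neighbour-between? : ∀ u v → Decidable (NeighbourBetween u v)
  neighbour-between? u v w = T? (adj G u w) ×-dec pos u ℕ.<? pos w ×-dec pos w ℕ.<? pos v

  covered-without-neighbour-between : ∀ {u v} → (∀ {w} → ¬ NeighbourBetween u v w) →
    EdgesCovered G ⟦ pos u , pos v ⟧ ⟦ suc (pos u) , pos v ⟧ (λ _ → false) u v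
  covered-without-neighbour-between {u} {v} none = covered-if-ordered ordered
    where
    ordered : ∀ {i j} → pos i ≤ pos j → T (adj G i j) → Both ⟦ pos u , pos v ⟧ i j →
              Both ⟦ suc (pos u) , pos v ⟧ i j ⊎ Both (λ _ → false) i j ⊎ (i ≡ u × j ≡ v)
    ordered {i} {j} i≤j a (Ri , Rj) with T-range⁻ {pos u} {pos v} Ri | T-range⁻ {pos u} {pos v} Rj
    ... | u≤i , i≤v | u≤j , j≤v with m≤n⇒m<n∨m≡n u≤i
    ...   | inj₁ u<i = inj₁ (T-range⁺ u<i i≤v , T-range⁺ (<-≤-trans u<i i≤j) j≤v)
    ...   | inj₂ u≡i = inj₂ (inj₂ (i≡u , j≡v))
      where
      i≡u = pos-injective (≡.sym u≡i)
      a′ : T (adj G u j)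
      a′ = subst (λ x → T (adj G x j)) i≡u a
      u<j : pos u < pos j
      u<j = ℕ.≤∧≢⇒< u≤j λ u≡j → adj-irrefl G (subst (λ x → T (adj G u x)) (pos-injective (≡.sym u≡j)) a′)
      j≡v = pos-injective (≤-antisym j≤v (≮⇒≥ λ j<v → none (a′ , u<j , j<v)))

  covered-by-farthest-neighbour : ∀ {u k v} → T (adj G u k) → pos u < pos k →
    (∀ {w} → NeighbourBetween u v w → pos w ≤ pos k) →
    EdgesCovered G ⟦ pos u , pos v ⟧ ⟦ pos u , pos k ⟧ ⟦ pos k , pos v ⟧ u v
  covered-by-farthest-neighbour {u} {k} {v} uk u<k farthest = covered-if-ordered ordered
    where
    ordered : ∀ {i j} → pos i ≤ pos j → T (adj G i j) → Both ⟦ pos u , pos v ⟧ i j →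
              Both ⟦ pos u , pos k ⟧ i j ⊎ Both ⟦ pos k , pos v ⟧ i j ⊎ (i ≡ u × j ≡ v)
    ordered {i} {j} i≤j a (Ri , Rj)
      with T-range⁻ {pos u} {pos v} Ri | T-range⁻ {pos u} {pos v} Rj | pos j ≤? pos k | pos k ≤? pos i
    ... | u≤i , _   | _ , j≤v | yes j≤k | _       =
      inj₁ (T-range⁺ u≤i (≤-trans i≤j j≤k) , T-range⁺ (≤-trans u≤i i≤j) j≤k)
    ... | _   , i≤v | _ , j≤v | no _    | yes k≤i =
      inj₂ (inj₁ (T-range⁺ k≤i i≤v , T-range⁺ (≤-trans k≤i i≤j) j≤v))
    ... | u≤i , _   | _ , j≤v | no j≰k  | no k≰i  = inj₂ (inj₂ (i≡u , j≡v))
      where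
      k<j = ≰⇒> j≰k
      -- otherwise the chords uk and ij cross
      u≡i : pos u ≡ pos i
      u≡i = Sum.[ (λ u<i → contradiction a (chords-do-not-cross u<i (≰⇒> k≰i) k<j uk)) , id ]
              (m≤n⇒m<n∨m≡n u≤i)
      i≡u = pos-injective (≡.sym u≡i)
      a′ : T (adj G u j)
      a′ = subst (λ x → T (adj G x j)) i≡u a
      j≡v = pos-injective (≤-antisym j≤v (≮⇒≥ λ j<v → <⇒≱ k<j (farthest (a′ , ℕ.<-trans u<k k<j , j<v))))

  WeakBound : (Fin n → Bool) → Set
  WeakBound R = 1 ≤ #X R → edges R + 2 ≤ sumOver R weight

  -- The bonus ⌊ χ u ∨ χ v ⌋ is what the induction needs when an interval is split at an X-vertex.
  StrongBound : Fin n → Fin n → Set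
  StrongBound u v = let I = ⟦ pos u , pos v ⟧ in
    1 ≤ #X I → edges I + 2 + ⌊ χ u ∨ χ v ⌋ ≤ sumOver I weight + ⌊ adj G u v ⌋

  weak-or-edgeless : ∀ {R m} → WeakBound R → m ≤ 2 → m ≤ sumOver R weight → edges R + m ≤ sumOver R weight
  weak-or-edgeless {R} {m} weak m≤2 m≤w with #X R in x
  ... | zero  rewrite edges-colourless {R} x = m≤w
  ... | suc _ = ≤-trans (+-monoʳ-≤ (edges R) m≤2) (weak (s≤s z≤n))

  strong-without-neighbour-between : ∀ {u v} → pos u < pos v → (∀ {w} → ¬ NeighbourBetween u v w) →
    WeakBound ⟦ suc (pos u) , pos v ⟧ → StrongBound u v
  strong-without-neighbour-between {u} {v} u<v none weak′ x≥1 = by-colour (χ u) refl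
    where
    I I′ : Fin n → Bool
    I  = ⟦ pos u , pos v ⟧
    I′ = ⟦ suc (pos u) , pos v ⟧
    e≤ : edges I ≤ edges I′ + ⌊ adj G u v ⌋
    e≤ = ≤-trans (edgesWithin-cover G (covered-without-neighbour-between none))
           (≤-reflexive (cong (_+ ⌊ adj G u v ⌋)
             (≡.trans (cong (edges I′ +_) edges-empty) (+-identityʳ (edges I′)))))
    first : ∀ f → sumOver I f ≡ f u + sumOver I′ f
    first f = sumOver-first u f (<⇒≤ u<v)
    by-colour : ∀ c → χ u ≡ c → edges I + 2 + ⌊ χ u ∨ χ v ⌋ ≤ sumOver I weight + ⌊ adj G u v ⌋
    by-colour true χu rewrite χu =
      drop-X-arith e≤ (weak-or-edgeless {I′} weak′ (s≤s z≤n) (weight-member I′ (T-range⁺ u<v ≤-refl)))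
        (≡.trans (first weight) (cong (λ c → 1 + ⌊ c ⌋ + sumOver I′ weight) χu))
    by-colour false χu rewrite χu =
      drop-Y-arith e≤ (weak′ (subst (1 ≤_) (≡.trans (first _) (cong (λ c → ⌊ c ⌋ + #X I′) χu)) x≥1))
        (≡.trans (first weight) (cong (λ c → 1 + ⌊ c ⌋ + sumOver I′ weight) χu)) (⌊⌋≤1 (χ v))

  strong-with-farthest-neighbour : ∀ {u k v} → NeighbourBetween u v k →
    (∀ {w} → NeighbourBetween u v w → pos w ≤ pos k) →
    WeakBound ⟦ pos u , pos k ⟧ → WeakBound ⟦ pos k , pos v ⟧ → StrongBound k v → StrongBound u v
  strong-with-farthest-neighbour {u} {k} {v} (uk , u<k , k<v) farthest weak₁ weak₂ strong₂ _ =
    by-colour (χ u) refl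
    where
    I I₁ I₂ : Fin n → Bool
    I  = ⟦ pos u , pos v ⟧
    I₁ = ⟦ pos u , pos k ⟧
    I₂ = ⟦ pos k , pos v ⟧
    e≤ : edges I ≤ edges I₁ + edges I₂ + ⌊ adj G u v ⌋
    e≤ = edgesWithin-cover G (covered-by-farthest-neighbour uk u<k farthest)
    cut : ∀ c → χ k ≡ c → sumOver I weight + (1 + ⌊ c ⌋) ≡ sumOver I₁ weight + sumOver I₂ weight
    cut c χk = ≡.trans (cong (λ c → sumOver I weight + (1 + ⌊ c ⌋)) (≡.sym χk))
                 (sumOver-cut k weight (<⇒≤ u<k) (<⇒≤ k<v))
    k∈I₁ : T (I₁ k)
    k∈I₁ = T-range⁺ (<⇒≤ u<k) ≤-refl
    k∈I₂ : T (I₂ k)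
    k∈I₂ = T-range⁺ ≤-refl (<⇒≤ k<v)
    two≤I₂ : 2 ≤ sumOver I₂ weight
    two≤I₂ = ≤-trans (+-mono-≤ (s≤s z≤n) (weight-member ⟦ suc (pos k) , pos v ⟧ (T-range⁺ k<v ≤-refl)))
               (≤-reflexive (≡.sym (sumOver-first k weight (<⇒≤ k<v))))
    by-colour : ∀ c → χ u ≡ c → edges I + 2 + ⌊ χ u ∨ χ v ⌋ ≤ sumOver I weight + ⌊ adj G u v ⌋
    by-colour true χu rewrite χu =
      split-X-arith e≤ (weak₁ (#X-member I₁ (T-range⁺ ≤-refl (<⇒≤ u<k)) χu))
        (weak-or-edgeless {I₂} weak₂ ≤-refl two≤I₂) (cut false (≡.trans (proper uk) (cong not χu)))
    by-colour false χu rewrite χu =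
      split-Y-arith e≤ (weak₁ (#X-member I₁ k∈I₁ χk))
        (subst (λ c → edges I₂ + 2 + ⌊ c ∨ χ v ⌋ ≤ sumOver I₂ weight + ⌊ adj G k v ⌋) χk
          (strong₂ (#X-member I₂ k∈I₂ χk)))
        (cut true χk) (adj+χ≤1 χk)
      where
      χk : χ k ≡ true
      χk = ≡.trans (proper uk) (cong not χu)

  weak-cong : ∀ {R S} → (∀ w → R w ≡ S w) → WeakBound S → WeakBound R
  weak-cong {R} {S} R≗S weak x≥1 =
    ≡.subst₂ _≤_ (cong (_+ 2) (≡.sym (edgesWithin-cong G R≗S))) (≡.sym (sumOver-cong weight R≗S))
      (weak (subst (1 ≤_) (sumOver-cong _ R≗S) x≥1))

  weak-of-chord : ∀ {u v} → StrongBound u v → WeakBound ⟦ pos u , pos v ⟧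
  weak-of-chord {u} {v} strong x≥1 = chord-arith (strong x≥1) (adj≤χ∨χ u v)

  weak-of-point : ∀ u → WeakBound ⟦ pos u , pos u ⟧
  weak-of-point u x≥1 rewrite edges-point u | sumOver-point u weight =
    s≤s (subst (1 ≤_) (sumOver-point u _) x≥1)

  interval-hull : ∀ {s t w} → T (⟦ s , t ⟧ w) →
    ∃ λ u → ∃ λ v → s ≤ pos u × pos v ≤ t × pos u ≤ pos v ×
                    (∀ x → ⟦ s , t ⟧ x ≡ ⟦ pos u , pos v ⟧ x)
  interval-hull {s} {t} w∈ =
    let u , u∈ , u≤ = Extremes.minimiser (T? ∘ ⟦ s , t ⟧) pos w∈
        v , v∈ , ≤v = Extremes.maximiser (T? ∘ ⟦ s , t ⟧) pos w∈
        s≤u , _ = T-range⁻ {s} {t} u∈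
        _ , v≤t = T-range⁻ {s} {t} v∈
    in u , v , s≤u , v≤t , u≤ v∈ , λ x → T-ext
      (λ x∈ → T-range⁺ (u≤ x∈) (≤v x∈))
      (λ x∈ → let u≤x , x≤v = T-range⁻ {pos u} {pos v} x∈ in T-range⁺ (≤-trans s≤u u≤x) (≤-trans x≤v v≤t))

  weak-from-strong : ∀ {s t} → (∀ {u v} → s ≤ pos u → pos v ≤ t → pos u < pos v → StrongBound u v) →
    WeakBound ⟦ s , t ⟧
  weak-from-strong {s} {t} strong x≥1 =
    let w , w∈ = sumOver-witness ⟦ s , t ⟧ _ x≥1
        u , v , s≤u , v≤t , u≤v , hull = interval-hull w∈
        weak-hull : WeakBound ⟦ pos u , pos v ⟧
        weak-hull = Sum.[ (λ u<v → weak-of-chord (strong s≤u v≤t u<v))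
                        , (λ u≡v → subst (λ y → WeakBound ⟦ pos u , y ⟧) u≡v (weak-of-point u)) ]′
                      (m≤n⇒m<n∨m≡n u≤v)
    in weak-cong hull weak-hull x≥1

  shorten : ∀ {L a b c} → a < b → c ≤ suc L + a → c ≤ L + b
  shorten {L} {a} a<b c≤ = ≤-trans c≤ (≤-trans (≤-reflexive (≡.sym (+-suc L a))) (+-monoʳ-≤ L a<b))

  strong-bound : ∀ L {u v} → pos u < pos v → pos v ≤ L + pos u → StrongBound u v
  weak-bound : ∀ L {s t} → t ≤ L + s → WeakBound ⟦ s , t ⟧

  strong-bound zero    u<v v≤u = contradiction v≤u (<⇒≱ u<v)
  strong-bound (suc L) {u} {v} u<v v≤ with Fin.any? (neighbour-between? u v)
  ... | no none = strong-without-neighbour-between u<v (none ∘ (_ ,_)) (weak-bound L (shorten ≤-refl v≤))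
  ... | yes (_ , between) =
    let k , k-between@(_ , u<k , k<v) , farthest = Extremes.maximiser (neighbour-between? u v) pos between in
    strong-with-farthest-neighbour k-between farthest (weak-bound L (≤-pred (≤-trans k<v v≤)))
      (weak-bound L (shorten u<k v≤)) (strong-bound L k<v (shorten u<k v≤))

  weak-bound L t≤ = weak-from-strong λ s≤u v≤t u<v →
    strong-bound L u<v (≤-trans v≤t (≤-trans t≤ (+-monoʳ-≤ L s≤u)))

  edges-bound : 1 ≤ #X (λ _ → true) → edges (λ _ → true) + 2 ≤ sumOver (λ _ → true) weight
  edges-bound = weak-cong everything (weak-bound n (ℕ.m≤m+n n 0))
    where
    everything : ∀ w → true ≡ ⟦ 0 , n ⟧ w
    everything w = ≡.sym (range-in z≤n (<⇒≤ (Fin.toℕ<n (proj₁ O w))))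

sum-map-tabulate : ∀ {a} {A : Set a} (g : Fin n → A) (f : A → ℕ) →
                   List.sum (map f (tabulate g)) ≡ ∑[ i < n ] f (g i)
sum-map-tabulate {zero}  g f = refl
sum-map-tabulate {suc n} g f = cong (f (g zero) +_) (sum-map-tabulate (g ∘ suc) f)

∑-const-1 : ∀ n → ∑[ i < n ] 1 ≡ n
∑-const-1 zero    = refl
∑-const-1 (suc n) = cong suc (∑-const-1 n)

∑⌊lookup⌋≡∣∣ : (X : Subset n) → ∑[ i < n ] ⌊ lookup X i ⌋ ≡ ∣ X ∣
∑⌊lookup⌋≡∣∣ Vec.[]          = refl
∑⌊lookup⌋≡∣∣ (true Vec.∷ X)  = cong suc (∑⌊lookup⌋≡∣∣ X)
∑⌊lookup⌋≡∣∣ (false Vec.∷ X) = ∑⌊lookup⌋≡∣∣ X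

e≡edgesWithin : (G : Graph n) → e G ≡ edgesWithin G (λ _ → true)
e≡edgesWithin {n} G = ≡.trans (sum-map-tabulate id (λ i → List.sum (map (edge i) (allFin n))))
  (sum-cong-≗ λ i → sum-map-tabulate id (edge i))
  where
  edge : Fin n → Fin n → ℕ
  edge i j = ⌊ does (i <? j) ∧ adj G i j ⌋

sumOver-everything : (f : Fin n → ℕ) → sumOver (λ _ → true) f ≡ ∑[ i < n ] f i
sumOver-everything f = sum-cong-≗ (λ i → +-identityʳ (f i))

lookup-∉ : {X : Subset n} {i : Fin n} → i ∉ X → lookup X i ≡ false
lookup-∉ {X = X} {i} i∉X with lookup X i in eq
... | true  = contradiction (lookup⇒[]= i X eq) i∉X
... | false = refl

bipartition-colouring : {G : Graph n} {X : Subset n} → IsBipartition G X →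
  ∀ {i j} → T (adj G i j) → lookup X j ≡ not (lookup X i)
bipartition-colouring bipartite {i} {j} a with bipartite i j (Equivalence.to T-≡ a)
... | inj₁ (i∈X , j∉X) rewrite []=⇒lookup i∈X | lookup-∉ j∉X = refl
... | inj₂ (i∉X , j∈X) rewrite lookup-∉ i∉X | []=⇒lookup j∈X = refl

lemma1p5 : (n : ℕ) (G : Graph n) (X : Subset n) →
    Outerplanar G → IsBipartition G X →
    1 ≤ ∣ X ∣ → ∣ X ∣ ≤ ∣ ∁ X ∣ →
    e G + 2 ≤ n + ∣ X ∣
-- Any non-empty colour class works.
lemma1p5 n G X outerplanar bipartite 1≤∣X∣ _ = begin
  e G + 2                             ≡⟨ cong (_+ 2) (e≡edgesWithin G) ⟩
  edgesWithin G (λ _ → true) + 2      ≤⟨ edges-bound (subst (1 ≤_) ∣X∣≡ 1≤∣X∣) ⟩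
  sumOver (λ _ → true) weight         ≡⟨ sumOver-everything weight ⟩
  ∑[ i < n ] (1 + ⌊ lookup X i ⌋)     ≡⟨ ∑-distrib-+ {n} (λ _ → 1) (λ i → ⌊ lookup X i ⌋) ⟩
  ∑[ i < n ] 1 + ∑[ i < n ] ⌊ lookup X i ⌋ ≡⟨ ≡.cong₂ _+_ (∑-const-1 n) (∑⌊lookup⌋≡∣∣ X) ⟩
  n + ∣ X ∣                           ∎
  where
  open ≤-Reasoning
  open OuterplanarColouring G outerplanar (lookup X) (bipartition-colouring {G = G} {X} bipartite)
  ∣X∣≡ : ∣ X ∣ ≡ #X (λ _ → true)
  ∣X∣≡ = ≡.sym (≡.trans (sumOver-everything (λ i → ⌊ lookup X i ⌋)) (∑⌊lookup⌋≡∣∣ X))
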